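{- For every labelled formula $L$ of $\mathsf{CPL}_0$, if the sequent $\vdash L$ is valid, then $\vdash L$ is derivable in the proof system for $\mathsf{CPL}_0$.
   Context: Let $2^\omega=\{0,1\}^{\mathbb N}$ with its Borel $\sigma$-algebra and the standard fair-coin measure $\mu$; $\mathrm{Cyl}(i)=\{f\in 2^\omega\mid f(i)=1\}$. Formulas of $\mathsf{CPL}_0$: $A,B::= \mathbf i\mid\neg A\mid A\wedge B\mid A\vee B\mid \mathbf C^qA\mid \mathbf D^qA$ with $i\in\mathbb N$, $q\in\mathbb Q\cap[0,1]$. Semantics $[\![A]\!]\subseteq 2^\omega$: $[\![\mathbf i]\!]=\mathrm{Cyl}(i)$; $\neg,\wedge,\vee$ are complement, intersection, union; $[\![\mathbf C^qA]\!]=2^\omega$ if $\mu([\![A]\!])\ge q$ and $\emptyset$ otherwise; $[\![\mathbf D^qA]\!]=2^\omega$ if $\mu([\![A]\!])<q$ and $\emptyset$ otherwise. Boolean formulas: $\mathscr b,\mathscr c::=x_i\mid\top\mid\bot\mid\neg\mathscr b\mid \mathscr b\wedge\mathscr c\mid\mathscr b\vee\mathscr c$, with $[\![x_i]\!]=\mathrm{Cyl}(i)$, $[\![\top]\!]=2^\omega$, $[\![\bot]\!]=\emptyset$, and connectives as set operations. $\mathscr b\vDash\mathscr c$ means $[\![\mathscr b]\!]\subseteq[\![\mathscr c]\!]$. A labelled formula is $\mathscr b\rightarrowtail A$ or $\mathscr b\leftarrowtail A$; a sequent is $\vdash L$ with $L$ labelled. $\mathscr b\rightarrowtail A$ (resp.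 $\mathscr b\leftarrowtail A$) is valid iff $[\![\mathscr b]\!]\subseteq[\![A]\!]$ (resp. $[\![A]\!]\subseteq[\![\mathscr b]\!]$); $\vdash L$ is valid iff $L$ is. Rules (side conditions are semantic facts that must hold): (Ax1) if $\mathscr b\vDash x_n$ then $\vdash\mathscr b\rightarrowtail\mathbf n$; (Ax2) if $x_n\vDash\mathscr b$ then $\vdash\mathscr b\leftarrowtail\mathbf n$; ($R^{\rightarrowtail}_\cup$) from $\vdash\mathscr c\rightarrowtail A$, $\vdash\mathscr d\rightarrowtail A$ and $\mathscr b\vDash\mathscr c\vee\mathscr d$ infer $\vdash\mathscr b\rightarrowtail A$; ($R^{\leftarrowtail}_\cap$) from $\vdash\mathscr c\leftarrowtail A$, $\vdash\mathscr d\leftarrowtail A$ and $\mathscr c\wedge\mathscr d\vDash\mathscr b$ infer $\vdash\mathscr b\leftarrowtail A$; ($R^{\rightarrowtail}_\neg$) from $\vdash\mathscr c\leftarrowtail A$ and $\mathscr b\vDash\neg\mathscr c$ infer $\vdash\mathscr b\rightarrowtail\neg A$; ($R^{\leftarrowtail}_\neg$) from $\vdash\mathscr c\rightarrowtail A$ and $\neg\mathscr c\vDash\mathscr b$ infer $\vdash\mathscr b\leftarrowtail\neg A$; from $\vdash\mathscr b\rightarrowtail A$ infer $\vdash\mathscr b\rightarrowtail A\vee B$; from $\vdash\mathscr b\rightarrowtail B$ infer $\vdash\mathscr b\rightarrowtail A\vee B$; from $\vdash\mathscr b\leftarrowtail A$ and $\vdash\mathscr b\leftarrowtail B$ infer $\vdash\mathscr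 b\leftarrowtail A\vee B$; from $\vdash\mathscr b\rightarrowtail A$ and $\vdash\mathscr b\rightarrowtail B$ infer $\vdash\mathscr b\rightarrowtail A\wedge B$; from $\vdash\mathscr b\leftarrowtail A$ infer $\vdash\mathscr b\leftarrowtail A\wedge B$; from $\vdash\mathscr b\leftarrowtail B$ infer $\vdash\mathscr b\leftarrowtail A\wedge B$; if $\mu([\![\mathscr b]\!])=0$ then $\vdash\mathscr b\rightarrowtail A$; if $\mu([\![\mathscr b]\!])=1$ then $\vdash\mathscr b\leftarrowtail A$; from $\vdash\mathscr c\rightarrowtail A$ and $\mu([\![\mathscr c]\!])\ge q$ infer $\vdash\mathscr b\rightarrowtail\mathbf C^qA$; from $\vdash\mathscr c\leftarrowtail A$ and $\mu([\![\mathscr c]\!])<q$ infer $\vdash\mathscr b\leftarrowtail\mathbf C^qA$; from $\vdash\mathscr c\leftarrowtail A$ and $\mu([\![\mathscr c]\!])<q$ infer $\vdash\mathscr b\rightarrowtail\mathbf D^qA$; from $\vdash\mathscr c\rightarrowtail A$ and $\mu([\![\mathscr c]\!])\ge q$ infer $\vdash\mathscr b\leftarrowtail\mathbf D^qA$ (in the last four rules $\mathscr b$ is arbitrary). Derivations are defined as usual. -}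

module Defs where

open import Data.Nat as ℕ using (ℕ; zero; suc; _⊔_)
open import Data.Nat.Properties using (m^n≢0)
open import Data.Bool using (Bool; true; false; not; _∧_; _∨_; if_then_else_)
open import Data.Integer using (+_)
open import Data.Rational as ℚ using (ℚ; 0ℚ; 1ℚ; _≤_; _<_; _≤ᵇ_)
open import Relation.Binary.PropositionalEquality using (_≡_)

Cantor : Set
Cantor = ℕ → Bool

Subset : Set₁
Subset = Cantor → Set

Cyl : ℕ → Subset
Cyl i f = f i ≡ true

_⊆_ : Subset → Subset → Set
X ⊆ Y = ∀ f → X f → Y f

-- Fair-coin measure of a set determined by its first n coordinates.
-- If g : Cantor → Bool depends only on the coordinates < n, then
-- μ {f | g f = true} = #{ v ∈ 2^n | g (v ++ 0^ω) = true } / 2^n.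

cons : Bool → Cantor → Cantor
cons b f zero    = b
cons b f (suc i) = f i

allFalse : Cantor
allFalse _ = false

count : ℕ → (Cantor → Bool) → ℕ
count zero    g = if g allFalse then 1 else 0
count (suc n) g = count n (λ f → g (cons false f)) ℕ.+ count n (λ f → g (cons true f))

μ-fin : ℕ → (Cantor → Bool) → ℚ
μ-fin n g = (+ count n g) ℚ./ (2 ℕ.^ n)
  where instance _ = m^n≢0 2 n

data Formula : Set where
  atom : ℕ → Formula
  ¬'_  : Formula → Formula
  _∧'_ : Formula → Formula → Formula
  _∨'_ : Formula → Formula → Formula
  C    : (q : ℚ) → 0ℚ ≤ q → q ≤ 1ℚ → Formula → Formula
  D    : (q : ℚ) → 0ℚ ≤ q → q ≤ 1ℚ → Formula → Formula

-- a bound n such that ⟦A⟧ depends only on coordinates < n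
supp : Formula → ℕ
supp (atom i)      = suc i
supp (¬' A)        = supp A
supp (A ∧' B)      = supp A ⊔ supp B
supp (A ∨' B)      = supp A ⊔ supp B
supp (C q _ _ A)   = 0
supp (D q _ _ A)   = 0

mutual
  evalF : Formula → Cantor → Bool
  evalF (atom i)    f = f i
  evalF (¬' A)      f = not (evalF A f)
  evalF (A ∧' B)    f = evalF A f ∧ evalF B f
  evalF (A ∨' B)    f = evalF A f ∨ evalF B f
  evalF (C q _ _ A) f = q ≤ᵇ μF A
  evalF (D q _ _ A) f = not (q ≤ᵇ μF A)

  μF : Formula → ℚ
  μF A = μ-fin (supp A) (evalF A)

⟦_⟧ : Formula → Subset
⟦ A ⟧ f = evalF A f ≡ true

data BFormula : Set where
  x  : ℕ → BFormula
  ⊤' : BFormula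
  ⊥' : BFormula
  ~_ : BFormula → BFormula
  _&_ : BFormula → BFormula → BFormula
  _∣_ : BFormula → BFormula → BFormula

evalB : BFormula → Cantor → Bool
evalB (x i)   f = f i
evalB ⊤'      f = true
evalB ⊥'      f = false
evalB (~ b)   f = not (evalB b f)
evalB (b & c) f = evalB b f ∧ evalB c f
evalB (b ∣ c) f = evalB b f ∨ evalB c f

suppB : BFormula → ℕ
suppB (x i)   = suc i
suppB ⊤'      = 0
suppB ⊥'      = 0
suppB (~ b)   = suppB b
suppB (b & c) = suppB b ⊔ suppB c
suppB (b ∣ c) = suppB b ⊔ suppB c

⟦_⟧B : BFormula → Subset
⟦ b ⟧B f = evalB b f ≡ true

μB : BFormula → ℚ
μB b = μ-fin (suppB b) (evalB b)

_⊨_ : BFormula → BFormula → Set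
b ⊨ c = ⟦ b ⟧B ⊆ ⟦ c ⟧B

data Labelled : Set where
  _↣_ : BFormula → Formula → Labelled
  _↢_ : BFormula → Formula → Labelled

Valid : Labelled → Set
Valid (b ↣ A) = ⟦ b ⟧B ⊆ ⟦ A ⟧
Valid (b ↢ A) = ⟦ A ⟧ ⊆ ⟦ b ⟧B

infix 4 ⊢_
data ⊢_ : Labelled → Set where
  Ax1 : ∀ {b n} → b ⊨ x n → ⊢ b ↣ atom n
  Ax2 : ∀ {b n} → x n ⊨ b → ⊢ b ↢ atom n
  R↣∪ : ∀ {b c d A} → ⊢ c ↣ A → ⊢ d ↣ A → b ⊨ (c ∣ d) → ⊢ b ↣ A
  R↢∩ : ∀ {b c d A} → ⊢ c ↢ A → ⊢ d ↢ A → (c & d) ⊨ b → ⊢ b ↢ A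
  R↣¬ : ∀ {b c A} → ⊢ c ↢ A → b ⊨ (~ c) → ⊢ b ↣ (¬' A)
  R↢¬ : ∀ {b c A} → ⊢ c ↣ A → (~ c) ⊨ b → ⊢ b ↢ (¬' A)
  R↣∨₁ : ∀ {b A B} → ⊢ b ↣ A → ⊢ b ↣ (A ∨' B)
  R↣∨₂ : ∀ {b A B} → ⊢ b ↣ B → ⊢ b ↣ (A ∨' B)
  R↢∨ : ∀ {b A B} → ⊢ b ↢ A → ⊢ b ↢ B → ⊢ b ↢ (A ∨' B)
  R↣∧ : ∀ {b A B} → ⊢ b ↣ A → ⊢ b ↣ B → ⊢ b ↣ (A ∧' B)
  R↢∧₁ : ∀ {b A B} → ⊢ b ↢ A → ⊢ b ↢ (A ∧' B)
  R↢∧₂ : ∀ {b A B} → ⊢ b ↢ B → ⊢ b ↢ (A ∧' B)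
  R↣μ0 : ∀ {b A} → μB b ≡ 0ℚ → ⊢ b ↣ A
  R↢μ1 : ∀ {b A} → μB b ≡ 1ℚ → ⊢ b ↢ A
  R↣C : ∀ {b c q p₀ p₁ A} → ⊢ c ↣ A → q ≤ μB c → ⊢ b ↣ C q p₀ p₁ A
  R↢C : ∀ {b c q p₀ p₁ A} → ⊢ c ↢ A → μB c < q → ⊢ b ↢ C q p₀ p₁ A
  R↣D : ∀ {b c q p₀ p₁ A} → ⊢ c ↢ A → μB c < q → ⊢ b ↣ D q p₀ p₁ A
  R↢D : ∀ {b c q p₀ p₁ A} → ⊢ c ↣ A → q ≤ μB c → ⊢ b ↢ D q p₀ p₁ A

{-# OPTIONS --safe #-}
module Submission where

open import Defs

open import Data.Nat as ℕ using (zero; suc; _⊔_)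
open import Data.Nat.Properties using (m^n≢0)
open import Data.Bool using (Bool; true; false; not; T; _∧_; _∨_; if_then_else_)
open import Data.Bool.Properties using (∧-conicalˡ; ∧-conicalʳ; ∨-zeroʳ)
open import Data.Integer using (+_)
open import Data.Rational using (_≤_; _<_; _≤ᵇ_)
open import Data.Rational.Properties using (≤ᵇ⇒≤; ≤⇒≤ᵇ; ≰⇒>; /-cong)
open import Function using (_∘_; id)
open import Relation.Binary.PropositionalEquality

-- Every formula A has a Boolean counterpart ⌜ A ⌝ with the same semantics, obtained by
-- replacing each counting subformula by ⊤' or ⊥' according to its truth value.
-- By induction on A, both ⊢ ⌜ A ⌝ ↣ A and ⊢ ⌜ A ⌝ ↢ A are derivable, and R↣∪ and R↢∩
-- (with c = d) let one then replace ⌜ A ⌝ by any b with ⟦ b ⟧ ⊆ ⟦ A ⟧, resp. ⟦ A ⟧ ⊆ ⟦ b ⟧.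

count-cong : ∀ n {g h : Cantor → Bool} → g ≗ h → count n g ≡ count n h
count-cong zero    g≗h = cong (if_then 1 else 0) (g≗h allFalse)
count-cong (suc n) g≗h =
  cong₂ ℕ._+_ (count-cong n (g≗h ∘ cons false)) (count-cong n (g≗h ∘ cons true))

μ-fin-cong : ∀ {m n} {g h : Cantor → Bool} → m ≡ n → g ≗ h → μ-fin m g ≡ μ-fin n h
μ-fin-cong {n = n} refl g≗h =
  /-cong {{m^n≢0 2 n}} {{m^n≢0 2 n}} (cong +_ (count-cong n g≗h)) refl

≤ᵇ≡true⇒≤ : ∀ {p q} → (p ≤ᵇ q) ≡ true → p ≤ q
≤ᵇ≡true⇒≤ p≤ᵇq = ≤ᵇ⇒≤ (subst T (sym p≤ᵇq) _)

≤ᵇ≡false⇒> : ∀ {p q} → (p ≤ᵇ q) ≡ false → q < p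
≤ᵇ≡false⇒> p≰ᵇq = ≰⇒> (subst T p≰ᵇq ∘ ≤⇒≤ᵇ)

⌜_⌝ : Formula → BFormula
⌜ atom i ⌝    = x i
⌜ ¬' A ⌝      = ~ ⌜ A ⌝
⌜ A ∧' B ⌝    = ⌜ A ⌝ & ⌜ B ⌝
⌜ A ∨' B ⌝    = ⌜ A ⌝ ∣ ⌜ B ⌝
⌜ C q _ _ A ⌝ = if q ≤ᵇ μF A then ⊤' else ⊥'
⌜ D q _ _ A ⌝ = if q ≤ᵇ μF A then ⊥' else ⊤'

evalB-⌜⌝ : ∀ A → evalB ⌜ A ⌝ ≗ evalF A
evalB-⌜⌝ (atom i)    f = refl
evalB-⌜⌝ (¬' A)      f = cong not (evalB-⌜⌝ A f)
evalB-⌜⌝ (A ∧' B)    f = cong₂ _∧_ (evalB-⌜⌝ A f) (evalB-⌜⌝ B f)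
evalB-⌜⌝ (A ∨' B)    f = cong₂ _∨_ (evalB-⌜⌝ A f) (evalB-⌜⌝ B f)
evalB-⌜⌝ (C q _ _ A) f with q ≤ᵇ μF A
... | true  = refl
... | false = refl
evalB-⌜⌝ (D q _ _ A) f with q ≤ᵇ μF A
... | true  = refl
... | false = refl

suppB-⌜⌝ : ∀ A → suppB ⌜ A ⌝ ≡ supp A
suppB-⌜⌝ (atom i)    = refl
suppB-⌜⌝ (¬' A)      = suppB-⌜⌝ A
suppB-⌜⌝ (A ∧' B)    = cong₂ _⊔_ (suppB-⌜⌝ A) (suppB-⌜⌝ B)
suppB-⌜⌝ (A ∨' B)    = cong₂ _⊔_ (suppB-⌜⌝ A) (suppB-⌜⌝ B)
suppB-⌜⌝ (C q _ _ A) with q ≤ᵇ μF A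
... | true  = refl
... | false = refl
suppB-⌜⌝ (D q _ _ A) with q ≤ᵇ μF A
... | true  = refl
... | false = refl

μB-⌜⌝ : ∀ A → μB ⌜ A ⌝ ≡ μF A
μB-⌜⌝ A = μ-fin-cong (suppB-⌜⌝ A) (evalB-⌜⌝ A)

↣-antitone : ∀ {b c A} → b ⊨ c → ⊢ c ↣ A → ⊢ b ↣ A
↣-antitone b⊨c ⊢c = R↣∪ ⊢c ⊢c (λ f b≡true → cong₂ _∨_ (b⊨c f b≡true) (b⊨c f b≡true))

↢-monotone : ∀ {b c A} → c ⊨ b → ⊢ c ↢ A → ⊢ b ↢ A
↢-monotone c⊨b ⊢c = R↢∩ ⊢c ⊢c (λ f cc≡true → c⊨b f (∧-conicalˡ _ _ cc≡true))

-- The R↣μ0 and R↢μ1 premises are refl because μB ⊥' and μB ⊤' compute to 0ℚ and 1ℚ.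
mutual
  ⌜⌝-↣ : ∀ A → ⊢ ⌜ A ⌝ ↣ A
  ⌜⌝-↣ (atom n)    = Ax1 (λ _ → id)
  ⌜⌝-↣ (¬' A)      = R↣¬ (⌜⌝-↢ A) (λ _ → id)
  ⌜⌝-↣ (A ∧' B)    = R↣∧ (↣-antitone (λ _ → ∧-conicalˡ _ _) (⌜⌝-↣ A))
                         (↣-antitone (λ _ → ∧-conicalʳ _ _) (⌜⌝-↣ B))
  ⌜⌝-↣ (A ∨' B)    = R↣∪ (R↣∨₁ (⌜⌝-↣ A)) (R↣∨₂ (⌜⌝-↣ B)) (λ _ → id)
  ⌜⌝-↣ (C q _ _ A) with q ≤ᵇ μF A in q≤ᵇμA
  ... | true  = R↣C (⌜⌝-↣ A) (subst (q ≤_) (sym (μB-⌜⌝ A)) (≤ᵇ≡true⇒≤ q≤ᵇμA))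
  ... | false = R↣μ0 refl
  ⌜⌝-↣ (D q _ _ A) with q ≤ᵇ μF A in q≤ᵇμA
  ... | true  = R↣μ0 refl
  ... | false = R↣D (⌜⌝-↢ A) (subst (_< q) (sym (μB-⌜⌝ A)) (≤ᵇ≡false⇒> q≤ᵇμA))

  ⌜⌝-↢ : ∀ A → ⊢ ⌜ A ⌝ ↢ A
  ⌜⌝-↢ (atom n)    = Ax2 (λ _ → id)
  ⌜⌝-↢ (¬' A)      = R↢¬ (⌜⌝-↣ A) (λ _ → id)
  ⌜⌝-↢ (A ∧' B)    = R↢∩ (R↢∧₁ (⌜⌝-↢ A)) (R↢∧₂ (⌜⌝-↢ B)) (λ _ → id)
  ⌜⌝-↢ (A ∨' B)    = R↢∨ (↢-monotone (λ _ → cong (_∨ _)) (⌜⌝-↢ A))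
                         (↢-monotone (λ _ ⌜B⌝≡true → trans (cong (_ ∨_) ⌜B⌝≡true) (∨-zeroʳ _))
                                     (⌜⌝-↢ B))
  ⌜⌝-↢ (C q _ _ A) with q ≤ᵇ μF A in q≤ᵇμA
  ... | true  = R↢μ1 refl
  ... | false = R↢C (⌜⌝-↢ A) (subst (_< q) (sym (μB-⌜⌝ A)) (≤ᵇ≡false⇒> q≤ᵇμA))
  ⌜⌝-↢ (D q _ _ A) with q ≤ᵇ μF A in q≤ᵇμA
  ... | true  = R↢D (⌜⌝-↣ A) (subst (q ≤_) (sym (μB-⌜⌝ A)) (≤ᵇ≡true⇒≤ q≤ᵇμA))
  ... | false = R↢μ1 refl

proposition2 : (L : Labelled) → Valid L → ⊢ L
proposition2 (b ↣ A) b⊆A = ↣-antitone (λ f → trans (evalB-⌜⌝ A f) ∘ b⊆A f) (⌜⌝-↣ A)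
proposition2 (b ↢ A) A⊆b = ↢-monotone (λ f → A⊆b f ∘ trans (sym (evalB-⌜⌝ A f))) (⌜⌝-↢ A)
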